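{- Let $G$ be a graph with nonnegative edge weights in which every vertex has positive degree, let $\ell\ge 0$ be an integer, let $i$ be a vertex, and let $e_i$ be the $i$-th standard basis vector. Then $$ q_i = \frac{1}{2^\ell}\, \mathcal{L}^\ell \left(\frac{1}{\sqrt{d_i}}\, e_i\right). $$
   Context: Let $A$ be the weighted adjacency matrix, $d_j$ the weighted degree of vertex $j$, $D$ the diagonal matrix with $D_{jj}=d_j$, and $\mathcal{L} = I - D^{ -1/2} A D^{ -1/2}$ the normalized Laplacian. A lazy random walk of length $\ell$ from $i$: at each of $\ell$ steps, with probability $1/2$ stay put, otherwise move from the current vertex $j$ to neighbor $k$ with probability $w_{jk}/d_j$. The hop-length of a walk is the number of steps in which it actually moved. Let $p^h_{i,j}$ be the probability that a length-$\ell$ lazy random walk from $i$ ends at $j$ with hop-length exactly $h$. Define $q_i\in\mathbb{R}^n$ by $q_i(j) = \frac{1}{\sqrt{d_j}}\sum_{h=0}^{\ell} (-1)^h p^h_{i,j}$. -}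

module Defs where

open import Level using (Level)
open import Algebra.Bundles using (CommutativeRing)
open import Data.Nat as ℕ using (ℕ; zero; suc)
open import Data.Fin as Fin using (Fin)
open import Data.Fin.Properties using () renaming (_≟_ to _≟ᶠ_)
open import Data.Nat.Properties using () renaming (_≟_ to _≟ⁿ_)
open import Data.Vec as Vec using (Vec; []; _∷_)
open import Data.List as List using (List; []; _∷_; _++_; concatMap; allFin)
open import Relation.Nullary using (does)
open import Data.Bool using (Bool; true; false; if_then_else_; _∧_)

module _ {c r : Level} (R : CommutativeRing c r) where
  open CommutativeRing R using (Carrier; _+_; _*_; -_; _-_; 0#; 1#)

  Σᶠ : (n : ℕ) → (Fin n → Carrier) → Carrier
  Σᶠ zero    f = 0#
  Σᶠ (suc n) f = f Fin.zero + Σᶠ n (λ k → f (Fin.suc k))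

  Σˡ : {A : Set} → List A → (A → Carrier) → Carrier
  Σˡ []       f = 0#
  Σˡ (x ∷ xs) f = f x + Σˡ xs f

  pow : Carrier → ℕ → Carrier
  pow x zero    = 1#
  pow x (suc m) = x * pow x m

  sign : ℕ → Carrier
  sign zero    = 1#
  sign (suc h) = - sign h

  𝟙 : Bool → Carrier
  𝟙 true  = 1#
  𝟙 false = 0#

  δ : {n : ℕ} → Fin n → Fin n → Carrier
  δ i j = 𝟙 (does (i ≟ᶠ j))

  _·_ : {n : ℕ} → (Fin n → Fin n → Carrier) → (Fin n → Carrier) → (Fin n → Carrier)
  _·_ {n} M v j = Σᶠ n (λ k → M j k * v k)

  matPow : {n : ℕ} → (Fin n → Fin n → Carrier) → ℕ → (Fin n → Carrier) → (Fin n → Carrier)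
  matPow M zero    v = v
  matPow M (suc m) v = M · matPow M m v

  degree : {n : ℕ} → (Fin n → Fin n → Carrier) → Fin n → Carrier
  degree {n} w j = Σᶠ n (λ k → w j k)

  -- Normalized Laplacian  I - D^{-1/2} A D^{-1/2}, where isqrt j plays the role of 1/sqrt(d_j)
  normLaplacian : {n : ℕ} → (w : Fin n → Fin n → Carrier) → (isqrt : Fin n → Carrier)
                → Fin n → Fin n → Carrier
  normLaplacian w isqrt j k = δ j k - isqrt j * w j k * isqrt k

  -- Lazy random walks.  A step is an element of Fin (suc n):
  -- Fin.zero = stay put, Fin.suc k = move to vertex k.
  Step : ℕ → Set
  Step n = Fin (suc n)

  allWalks : (n len : ℕ) → List (Vec (Step n) len)
  allWalks n zero      = [] ∷ []
  allWalks n (suc len) = concatMap (λ s → List.map (s ∷_) (allWalks n len)) (allFin (suc n))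

  endpoint : {n len : ℕ} → Fin n → Vec (Step n) len → Fin n
  endpoint v []                = v
  endpoint v (Fin.zero  ∷ ss)  = endpoint v ss
  endpoint v (Fin.suc k ∷ ss)  = endpoint k ss

  hops : {n len : ℕ} → Vec (Step n) len → ℕ
  hops []               = zero
  hops (Fin.zero  ∷ ss) = hops ss
  hops (Fin.suc k ∷ ss) = suc (hops ss)

  -- probability of a given step sequence from vertex v:
  -- stay with prob 1/2, move j → k with prob (1/2)·w_jk/d_j.
  -- half = 1/2, isqrt j = 1/sqrt(d_j), so 1/d_j = isqrt j * isqrt j.
  walkProb : {n len : ℕ} → (w : Fin n → Fin n → Carrier) → (isqrt : Fin n → Carrier)
           → (half : Carrier) → Fin n → Vec (Step n) len → Carrier
  walkProb w isqrt half v []               = 1#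
  walkProb w isqrt half v (Fin.zero  ∷ ss) = half * walkProb w isqrt half v ss
  walkProb w isqrt half v (Fin.suc k ∷ ss) =
    (half * (w v k * (isqrt v * isqrt v))) * walkProb w isqrt half k ss

  -- p^h_{i,j}: probability that a length-len lazy walk from i ends at j with hop-length h
  hopProb : {n : ℕ} → (w : Fin n → Fin n → Carrier) → (isqrt : Fin n → Carrier)
          → (half : Carrier) → (len h : ℕ) → Fin n → Fin n → Carrier
  hopProb {n} w isqrt half len h i j =
    Σˡ (allWalks n len) (λ s →
      𝟙 (does (endpoint i s ≟ᶠ j) ∧ does (hops s ≟ⁿ h)) * walkProb w isqrt half i s)

  qvec : {n : ℕ} → (w : Fin n → Fin n → Carrier) → (isqrt : Fin n → Carrier)
       → (half : Carrier) → (len : ℕ) → Fin n → Fin n → Carrier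
  qvec w isqrt half len i j =
    isqrt j * Σᶠ (suc len) (λ h → sign (Fin.toℕ h) * hopProb w isqrt half len (Fin.toℕ h) i j)

-- A lazy walk contributes the product of its step weights, and a step weighted
-- by (-1)^(hop) is an entry of ½(I − D⁻¹A): staying gives ½, moving j → k
-- gives −½ w_jk/d_j.  Splitting off the first step, the alternating sum
-- T_ℓ(i, j) = Σ_h (-1)^h p^h_{i,j} satisfies T_{ℓ+1}(i, ·) = ½ Σ_k (I − D⁻¹A)_{ik} T_ℓ(k, ·).
-- For symmetric A the similarity 𝓛 D^{-1/2} = D^{-1/2} (I − D⁻¹A)ᵀ shows that the
-- vectors 𝓛^ℓ D^{-1/2} e_i obey the same recursion, and both start at D^{-1/2} e_i.
module Submission where

open import Defs
open import Level using (Level)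
open import Algebra.Bundles using (CommutativeRing)
open import Data.Bool using (Bool; true; false; _∧_)
open import Data.Empty using (⊥-elim)
open import Data.Fin as Fin using (Fin; toℕ)
open import Data.Fin.Properties using () renaming (_≟_ to _≟ᶠ_)
open import Data.List as List using (List; []; _∷_; _++_; concatMap; allFin)
open import Data.Nat using (ℕ; zero; suc; _≤_; z≤n; s≤s)
open import Data.Nat.Properties using (m≤n⇒m≤1+n) renaming (_≟_ to _≟ⁿ_)
open import Data.Vec using (Vec; []; _∷_)
open import Function using (_∘_)
open import Relation.Binary.PropositionalEquality as ≡ using (_≡_)
open import Relation.Nullary using (does; yes; no)

module _ {c r : Level} (R : CommutativeRing c r) where
  open CommutativeRing R
  open import Algebra.Properties.Ring ring using (-‿distribˡ-*; -‿distribʳ-*)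
  open import Algebra.Properties.CommutativeSemigroup *-commutativeSemigroup
    using (x∙yz≈y∙xz; x∙yz≈z∙xy; x∙yz≈y∙zx; xy∙z≈y∙zx)
  open import Algebra.Properties.Semiring.Sum semiring
    using (sum; sum-cong-≋; sum-cong-≗; sum-replicate-zero; ∑-distrib-+; ∑-comm; *-distribˡ-sum)
  open import Relation.Binary.Reasoning.Setoid setoid

  Σᶠ≡sum : ∀ n (f : Fin n → Carrier) → Σᶠ R n f ≡ sum f
  Σᶠ≡sum zero    f = ≡.refl
  Σᶠ≡sum (suc n) f = ≡.cong (f Fin.zero +_) (Σᶠ≡sum n (f ∘ Fin.suc))

  Σᶠ-cong : ∀ n {f g : Fin n → Carrier} → (∀ k → f k ≈ g k) → Σᶠ R n f ≈ Σᶠ R n g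
  Σᶠ-cong n {f} {g} f≈g rewrite Σᶠ≡sum n f | Σᶠ≡sum n g = sum-cong-≋ f≈g

  Σᶠ-zero : ∀ n {f : Fin n → Carrier} → (∀ k → f k ≈ 0#) → Σᶠ R n f ≈ 0#
  Σᶠ-zero n {f} f≈0 rewrite Σᶠ≡sum n f = trans (sum-cong-≋ f≈0) (sum-replicate-zero n)

  Σᶠ-distrib-+ : ∀ n (f g : Fin n → Carrier) →
                 Σᶠ R n (λ k → f k + g k) ≈ Σᶠ R n f + Σᶠ R n g
  Σᶠ-distrib-+ n f g
    rewrite Σᶠ≡sum n (λ k → f k + g k) | Σᶠ≡sum n f | Σᶠ≡sum n g = ∑-distrib-+ f g

  *-distribˡ-Σᶠ : ∀ n x (f : Fin n → Carrier) → x * Σᶠ R n f ≈ Σᶠ R n (λ k → x * f k)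
  *-distribˡ-Σᶠ n x f rewrite Σᶠ≡sum n f | Σᶠ≡sum n (λ k → x * f k) = *-distribˡ-sum x f

  Σᶠ-comm : ∀ m n (f : Fin m → Fin n → Carrier) →
            Σᶠ R m (λ u → Σᶠ R n (f u)) ≈ Σᶠ R n (λ k → Σᶠ R m (λ u → f u k))
  Σᶠ-comm m n f = begin
    Σᶠ R m (λ u → Σᶠ R n (f u))    ≡⟨ Σᶠ²≡sum² m n f ⟩
    sum (λ u → sum (f u))          ≈⟨ ∑-comm f ⟩
    sum (λ k → sum (λ u → f u k))  ≡⟨ Σᶠ²≡sum² n m (λ k u → f u k) ⟨
    Σᶠ R n (λ k → Σᶠ R m (λ u → f u k)) ∎
    where
    Σᶠ²≡sum² : ∀ m n (g : Fin m → Fin n → Carrier) →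
               Σᶠ R m (λ u → Σᶠ R n (g u)) ≡ sum (λ u → sum (g u))
    Σᶠ²≡sum² m n g = ≡.trans (Σᶠ≡sum m _) (sum-cong-≗ (λ u → Σᶠ≡sum n (g u)))

  x*Σay≈Σa*xy : ∀ n x (a y : Fin n → Carrier) →
                x * Σᶠ R n (λ k → a k * y k) ≈ Σᶠ R n (λ k → a k * (x * y k))
  x*Σay≈Σa*xy n x a y =
    trans (*-distribˡ-Σᶠ n x _) (Σᶠ-cong n (λ k → x∙yz≈y∙xz x (a k) (y k)))

  δ-sym : ∀ {n} (u v : Fin n) → δ R u v ≈ δ R v u
  δ-sym u v with u ≟ᶠ v | v ≟ᶠ u
  ... | yes _      | yes _      = refl
  ... | no _       | no _       = refl
  ... | yes ≡.refl | no u≢u     = ⊥-elim (u≢u ≡.refl)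
  ... | no u≢u     | yes ≡.refl = ⊥-elim (u≢u ≡.refl)

  *-δ-transfer : ∀ {n} (f : Fin n → Carrier) (u v : Fin n) → f u * δ R u v ≈ f v * δ R u v
  *-δ-transfer f u v with u ≟ᶠ v
  ... | yes ≡.refl = refl
  ... | no _       = trans (zeroʳ _) (sym (zeroʳ _))

  Σᶠ-δ : ∀ n (v : Fin n) (f : Fin n → Carrier) → Σᶠ R n (λ k → δ R v k * f k) ≈ f v
  Σᶠ-δ (suc n) Fin.zero f = begin
    1# * f Fin.zero + Σᶠ R n (λ k → 0# * f (Fin.suc k))
      ≈⟨ +-cong (*-identityˡ _) (Σᶠ-zero n (λ k → zeroˡ _)) ⟩
    f Fin.zero + 0#  ≈⟨ +-identityʳ _ ⟩
    f Fin.zero       ∎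
  Σᶠ-δ (suc n) (Fin.suc v) f = begin
    0# * f Fin.zero + Σᶠ R n (λ k → δ R v k * f (Fin.suc k))
      ≈⟨ +-cong (zeroˡ _) (Σᶠ-δ n v (f ∘ Fin.suc)) ⟩
    0# + f (Fin.suc v)  ≈⟨ +-identityˡ _ ⟩
    f (Fin.suc v)       ∎

  Σᶠ-δ+ : ∀ n (v : Fin n) (b f : Fin n → Carrier) →
          f v + Σᶠ R n (λ k → b k * f k) ≈ Σᶠ R n (λ k → (δ R v k + b k) * f k)
  Σᶠ-δ+ n v b f = begin
    f v + Σᶠ R n (λ k → b k * f k)
      ≈⟨ +-congʳ (Σᶠ-δ n v f) ⟨
    Σᶠ R n (λ k → δ R v k * f k) + Σᶠ R n (λ k → b k * f k)
      ≈⟨ Σᶠ-distrib-+ n _ _ ⟨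
    Σᶠ R n (λ k → δ R v k * f k + b k * f k)
      ≈⟨ Σᶠ-cong n (λ k → distribʳ (f k) (δ R v k) (b k)) ⟨
    Σᶠ R n (λ k → (δ R v k + b k) * f k) ∎

  Σˡ-cong : {A : Set} (xs : List A) {f g : A → Carrier} →
            (∀ x → f x ≈ g x) → Σˡ R xs f ≈ Σˡ R xs g
  Σˡ-cong []       f≈g = refl
  Σˡ-cong (x ∷ xs) f≈g = +-cong (f≈g x) (Σˡ-cong xs f≈g)

  *-distribˡ-Σˡ : {A : Set} (xs : List A) (x : Carrier) (f : A → Carrier) →
                  x * Σˡ R xs f ≈ Σˡ R xs (λ a → x * f a)
  *-distribˡ-Σˡ []       x f = zeroʳ x
  *-distribˡ-Σˡ (a ∷ xs) x f = trans (distribˡ x _ _) (+-congˡ (*-distribˡ-Σˡ xs x f))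

  Σˡ-++ : {A : Set} (xs ys : List A) (f : A → Carrier) →
          Σˡ R (xs ++ ys) f ≈ Σˡ R xs f + Σˡ R ys f
  Σˡ-++ []       ys f = sym (+-identityˡ _)
  Σˡ-++ (x ∷ xs) ys f = trans (+-congˡ (Σˡ-++ xs ys f)) (sym (+-assoc _ _ _))

  Σˡ-concatMap : {A B : Set} (g : A → List B) (xs : List A) (f : B → Carrier) →
                 Σˡ R (concatMap g xs) f ≈ Σˡ R xs (λ x → Σˡ R (g x) f)
  Σˡ-concatMap g []       f = refl
  Σˡ-concatMap g (x ∷ xs) f =
    trans (Σˡ-++ (g x) (concatMap g xs) f) (+-congˡ (Σˡ-concatMap g xs f))

  Σˡ-map : {A B : Set} (g : A → B) (xs : List A) (f : B → Carrier) →
           Σˡ R (List.map g xs) f ≈ Σˡ R xs (f ∘ g)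
  Σˡ-map g []       f = refl
  Σˡ-map g (x ∷ xs) f = +-congˡ (Σˡ-map g xs f)

  Σˡ-tabulate : {A : Set} (n : ℕ) (g : Fin n → A) (f : A → Carrier) →
                Σˡ R (List.tabulate g) f ≈ Σᶠ R n (f ∘ g)
  Σˡ-tabulate zero    g f = refl
  Σˡ-tabulate (suc n) g f = +-congˡ (Σˡ-tabulate n (g ∘ Fin.suc) f)

  Σᶠ-Σˡ-comm : {A : Set} (m : ℕ) (xs : List A) (f : Fin m → A → Carrier) →
               Σᶠ R m (λ h → Σˡ R xs (f h)) ≈ Σˡ R xs (λ x → Σᶠ R m (λ h → f h x))
  Σᶠ-Σˡ-comm m []       f = Σᶠ-zero m (λ _ → refl)
  Σᶠ-Σˡ-comm m (x ∷ xs) f = trans (Σᶠ-distrib-+ m _ _) (+-congˡ (Σᶠ-Σˡ-comm m xs f))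

  x*[0*y]≈0 : ∀ x y → x * (0# * y) ≈ 0#
  x*[0*y]≈0 x y = trans (*-congˡ (zeroˡ y)) (zeroʳ x)

  Σᶠ-select : ∀ len a (F : ℕ → Carrier) (p : Carrier) → a ≤ len →
              Σᶠ R (suc len) (λ h → F (toℕ h) * (𝟙 R (does (a ≟ⁿ toℕ h)) * p)) ≈ F a * p
  Σᶠ-select zero zero F p z≤n = trans (+-identityʳ _) (*-congˡ (*-identityˡ p))
  Σᶠ-select (suc len) zero F p z≤n = begin
    F 0 * (1# * p) + Σᶠ R (suc len) (λ h → F (suc (toℕ h)) * (0# * p))
      ≈⟨ +-cong (*-congˡ (*-identityˡ p))
                (Σᶠ-zero (suc len) (λ h → x*[0*y]≈0 (F (suc (toℕ h))) p)) ⟩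
    F 0 * p + 0#  ≈⟨ +-identityʳ _ ⟩
    F 0 * p       ∎
  Σᶠ-select (suc len) (suc a) F p (s≤s a≤len) = begin
    F 0 * (0# * p) + Σᶠ R (suc len) (λ h → F (suc (toℕ h)) * (𝟙 R (does (a ≟ⁿ toℕ h)) * p))
      ≈⟨ +-cong (x*[0*y]≈0 (F 0) p) (Σᶠ-select len a (F ∘ suc) p a≤len) ⟩
    0# + F (suc a) * p  ≈⟨ +-identityˡ _ ⟩
    F (suc a) * p       ∎

  Σᶠ-select-∧ : ∀ len (b : Bool) a (F : ℕ → Carrier) (p : Carrier) → a ≤ len →
                Σᶠ R (suc len) (λ h → F (toℕ h) * (𝟙 R (b ∧ does (a ≟ⁿ toℕ h)) * p))
                  ≈ 𝟙 R b * (F a * p)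
  Σᶠ-select-∧ len false a F p _ =
    trans (Σᶠ-zero (suc len) (λ h → x*[0*y]≈0 (F (toℕ h)) p)) (sym (zeroˡ _))
  Σᶠ-select-∧ len true a F p a≤len =
    trans (Σᶠ-select len a F p a≤len) (sym (*-identityˡ _))

  hops≤length : ∀ {n len} (s : Vec (Step R n) len) → hops R s ≤ len
  hops≤length []               = z≤n
  hops≤length (Fin.zero  ∷ s) = m≤n⇒m≤1+n (hops≤length s)
  hops≤length (Fin.suc k ∷ s) = s≤s (hops≤length s)

  Σˡ-allWalks-suc : ∀ n m (f : Vec (Step R n) (suc m) → Carrier) →
                    Σˡ R (allWalks R n (suc m)) f
                      ≈ Σˡ R (allWalks R n m) (λ s → f (Fin.zero ∷ s))
                        + Σᶠ R n (λ k → Σˡ R (allWalks R n m) (λ s → f (Fin.suc k ∷ s)))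
  Σˡ-allWalks-suc n m f = begin
    Σˡ R (concatMap (λ st → List.map (st ∷_) W) (allFin (suc n))) f
      ≈⟨ Σˡ-concatMap (λ st → List.map (st ∷_) W) (allFin (suc n)) f ⟩
    Σˡ R (allFin (suc n)) (λ st → Σˡ R (List.map (st ∷_) W) f)
      ≈⟨ Σˡ-tabulate (suc n) (λ st → st) _ ⟩
    Σᶠ R (suc n) (λ st → Σˡ R (List.map (st ∷_) W) f)
      ≈⟨ Σᶠ-cong (suc n) (λ st → Σˡ-map (st ∷_) W f) ⟩
    Σᶠ R (suc n) (λ st → Σˡ R W (λ s → f (st ∷ s))) ∎
    where W = allWalks R n m

  module _ {n : ℕ} (M : Fin n → Fin n → Carrier) where

    matPow-cong : ∀ m {y z : Fin n → Carrier} → (∀ t → y t ≈ z t) →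
                  ∀ j → matPow R M m y j ≈ matPow R M m z j
    matPow-cong zero    y≈z j = y≈z j
    matPow-cong (suc m) y≈z j = Σᶠ-cong n (λ u → *-congˡ (matPow-cong m y≈z u))

    matPow-sucʳ : ∀ m (y : Fin n → Carrier) j →
                  matPow R M (suc m) y j ≈ matPow R M m (_·_ R M y) j
    matPow-sucʳ zero    y j = refl
    matPow-sucʳ (suc m) y j = Σᶠ-cong n (λ u → *-congˡ (matPow-sucʳ m y u))

    matPow-linear : ∀ m (a : Fin n → Carrier) (y : Fin n → Fin n → Carrier) j →
                    matPow R M m (λ t → Σᶠ R n (λ k → a k * y k t)) j
                      ≈ Σᶠ R n (λ k → a k * matPow R M m (y k) j)
    matPow-linear zero    a y j = refl
    matPow-linear (suc m) a y j = begin
      Σᶠ R n (λ u → M j u * matPow R M m (λ t → Σᶠ R n (λ k → a k * y k t)) u)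
        ≈⟨ Σᶠ-cong n (λ u → *-congˡ (matPow-linear m a y u)) ⟩
      Σᶠ R n (λ u → M j u * Σᶠ R n (λ k → a k * matPow R M m (y k) u))
        ≈⟨ Σᶠ-cong n (λ u → x*Σay≈Σa*xy n (M j u) a _) ⟩
      Σᶠ R n (λ u → Σᶠ R n (λ k → a k * (M j u * matPow R M m (y k) u)))
        ≈⟨ Σᶠ-comm n n _ ⟩
      Σᶠ R n (λ k → Σᶠ R n (λ u → a k * (M j u * matPow R M m (y k) u)))
        ≈⟨ Σᶠ-cong n (λ k → *-distribˡ-Σᶠ n (a k) _) ⟨
      Σᶠ R n (λ k → a k * matPow R M (suc m) (y k) j) ∎

  randomWalkLaplacian : ∀ {n} → (Fin n → Fin n → Carrier) → (Fin n → Carrier) →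
                        Fin n → Fin n → Carrier
  randomWalkLaplacian w isqrt v k = δ R v k - w v k * (isqrt v * isqrt v)

  module _ {n : ℕ} (w : Fin n → Fin n → Carrier) (isqrt : Fin n → Carrier) (half : Carrier) where

    alternatingWalkSum : ℕ → Fin n → Fin n → Carrier
    alternatingWalkSum m v j =
      Σˡ R (allWalks R n m) (λ s →
        𝟙 R (does (endpoint R v s ≟ᶠ j)) * (sign R (hops R s) * walkProb R w isqrt half v s))

    qvec≈isqrt*alternatingWalkSum : ∀ len i j →
      qvec R w isqrt half len i j ≈ isqrt j * alternatingWalkSum len i j
    qvec≈isqrt*alternatingWalkSum len i j = *-congˡ (begin
      Σᶠ R (suc len) (λ h → sign R (toℕ h) * Σˡ R W (λ s → ends s h * p s))
        ≈⟨ Σᶠ-cong (suc len) (λ h → *-distribˡ-Σˡ W (sign R (toℕ h)) (λ s → ends s h * p s)) ⟩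
      Σᶠ R (suc len) (λ h → Σˡ R W (λ s → sign R (toℕ h) * (ends s h * p s)))
        ≈⟨ Σᶠ-Σˡ-comm (suc len) W (λ h s → sign R (toℕ h) * (ends s h * p s)) ⟩
      Σˡ R W (λ s → Σᶠ R (suc len) (λ h → sign R (toℕ h) * (ends s h * p s)))
        ≈⟨ Σˡ-cong W (λ s → Σᶠ-select-∧ len (does (endpoint R i s ≟ᶠ j)) (hops R s)
                                        (sign R) (p s) (hops≤length s)) ⟩
      alternatingWalkSum len i j ∎)
      where
      W = allWalks R n len
      p = walkProb R w isqrt half i
      ends : Vec (Step R n) len → Fin (suc len) → Carrier
      ends s h = 𝟙 R (does (endpoint R i s ≟ᶠ j) ∧ does (hops R s ≟ⁿ toℕ h))

    alternatingWalkSum-suc : ∀ m v j →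
      alternatingWalkSum (suc m) v j
        ≈ half * Σᶠ R n (λ k → randomWalkLaplacian w isqrt v k * alternatingWalkSum m k j)
    alternatingWalkSum-suc m v j = begin
      alternatingWalkSum (suc m) v j
        ≈⟨ Σˡ-allWalks-suc n m f ⟩
      Σˡ R W (λ s → f (Fin.zero ∷ s)) + Σᶠ R n (λ k → Σˡ R W (λ s → f (Fin.suc k ∷ s)))
        ≈⟨ +-cong stay (Σᶠ-cong n move) ⟩
      half * T v j + Σᶠ R n (λ k → (half * b k) * T k j)
        ≈⟨ +-congˡ (Σᶠ-cong n (λ k → *-assoc half (b k) (T k j))) ⟩
      half * T v j + Σᶠ R n (λ k → half * (b k * T k j))
        ≈⟨ +-congˡ (*-distribˡ-Σᶠ n half _) ⟨
      half * T v j + half * Σᶠ R n (λ k → b k * T k j)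
        ≈⟨ distribˡ half _ _ ⟨
      half * (T v j + Σᶠ R n (λ k → b k * T k j))
        ≈⟨ *-congˡ (Σᶠ-δ+ n v b (λ k → T k j)) ⟩
      half * Σᶠ R n (λ k → randomWalkLaplacian w isqrt v k * T k j) ∎
      where
      W = allWalks R n m
      T = alternatingWalkSum m
      f : Vec (Step R n) (suc m) → Carrier
      f s = 𝟙 R (does (endpoint R v s ≟ᶠ j)) * (sign R (hops R s) * walkProb R w isqrt half v s)
      b : Fin n → Carrier
      b k = - (w v k * (isqrt v * isqrt v))

      x*yzw≈z*xyw : ∀ x y z u → x * (y * (z * u)) ≈ z * (x * (y * u))
      x*yzw≈z*xyw x y z u = trans (*-congˡ (x∙yz≈y∙xz y z u)) (x∙yz≈y∙xz x z (y * u))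

      stay : Σˡ R W (λ s → f (Fin.zero ∷ s)) ≈ half * T v j
      stay = trans (Σˡ-cong W (λ s → x*yzw≈z*xyw _ _ half _)) (sym (*-distribˡ-Σˡ W half _))

      move : ∀ k → Σˡ R W (λ s → f (Fin.suc k ∷ s)) ≈ (half * b k) * T k j
      move k = trans (Σˡ-cong W (λ s → hopWeight _ _ _ _))
                     (sym (*-distribˡ-Σˡ W (half * b k) _))
        where
        hopWeight : ∀ e σ X p → e * (- σ * ((half * X) * p)) ≈ (half * - X) * (e * (σ * p))
        hopWeight e σ X p = begin
          e * (- σ * ((half * X) * p))    ≈⟨ *-congˡ (-‿distribˡ-* σ _) ⟨
          e * - (σ * ((half * X) * p))    ≈⟨ *-congˡ (-‿distribʳ-* σ _) ⟩
          e * (σ * - ((half * X) * p))    ≈⟨ *-congˡ (*-congˡ (-‿distribˡ-* (half * X) p)) ⟩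
          e * (σ * (- (half * X) * p))    ≈⟨ *-congˡ (*-congˡ (*-congʳ (-‿distribʳ-* half X))) ⟩
          e * (σ * ((half * - X) * p))    ≈⟨ x*yzw≈z*xyw e σ (half * - X) p ⟩
          (half * - X) * (e * (σ * p))    ∎

  module _ {n : ℕ} (w : Fin n → Fin n → Carrier) (w-sym : ∀ j k → w j k ≈ w k j)
           (isqrt : Fin n → Carrier) where

    private
      𝓛 = normLaplacian R w isqrt
      S = randomWalkLaplacian w isqrt

    scaledBasis : Fin n → Fin n → Carrier
    scaledBasis v k = isqrt v * δ R v k

    normLaplacian-*-isqrt : ∀ t v → 𝓛 t v * isqrt v ≈ S v t * isqrt t
    normLaplacian-*-isqrt t v = begin
      (δ R t v - isqrt t * w t v * isqrt v) * isqrt v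
        ≈⟨ distribʳ _ _ _ ⟩
      δ R t v * isqrt v + - (isqrt t * w t v * isqrt v) * isqrt v
        ≈⟨ +-cong diagonal offDiagonal ⟩
      δ R v t * isqrt t + - (w v t * (isqrt v * isqrt v)) * isqrt t
        ≈⟨ distribʳ _ _ _ ⟨
      S v t * isqrt t ∎
      where
      diagonal : δ R t v * isqrt v ≈ δ R v t * isqrt t
      diagonal = begin
        δ R t v * isqrt v  ≈⟨ *-congʳ (δ-sym t v) ⟩
        δ R v t * isqrt v  ≈⟨ *-comm _ _ ⟩
        isqrt v * δ R v t  ≈⟨ *-δ-transfer isqrt v t ⟩
        isqrt t * δ R v t  ≈⟨ *-comm _ _ ⟩
        δ R v t * isqrt t  ∎
      offDiagonal : - (isqrt t * w t v * isqrt v) * isqrt v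
                      ≈ - (w v t * (isqrt v * isqrt v)) * isqrt t
      offDiagonal = begin
        - (isqrt t * w t v * isqrt v) * isqrt v     ≈⟨ -‿distribˡ-* _ _ ⟨
        - (isqrt t * w t v * isqrt v * isqrt v)     ≈⟨ -‿cong (*-congʳ (*-congʳ (*-congˡ (w-sym t v)))) ⟩
        - (isqrt t * w v t * isqrt v * isqrt v)     ≈⟨ -‿cong (*-assoc _ _ _) ⟩
        - (isqrt t * w v t * (isqrt v * isqrt v))   ≈⟨ -‿cong (xy∙z≈y∙zx _ _ _) ⟩
        - (w v t * ((isqrt v * isqrt v) * isqrt t)) ≈⟨ -‿cong (*-assoc _ _ _) ⟨
        - (w v t * (isqrt v * isqrt v) * isqrt t)   ≈⟨ -‿distribˡ-* _ _ ⟩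
        - (w v t * (isqrt v * isqrt v)) * isqrt t   ∎

    normLaplacian·scaledBasis : ∀ v t →
      _·_ R 𝓛 (scaledBasis v) t ≈ Σᶠ R n (λ k → S v k * scaledBasis k t)
    normLaplacian·scaledBasis v t = begin
      Σᶠ R n (λ u → 𝓛 t u * (isqrt v * δ R v u))
        ≈⟨ Σᶠ-cong n (λ u → x∙yz≈z∙xy (𝓛 t u) (isqrt v) (δ R v u)) ⟩
      Σᶠ R n (λ u → δ R v u * (𝓛 t u * isqrt v))
        ≈⟨ Σᶠ-δ n v _ ⟩
      𝓛 t v * isqrt v
        ≈⟨ normLaplacian-*-isqrt t v ⟩
      S v t * isqrt t
        ≈⟨ Σᶠ-δ n t _ ⟨
      Σᶠ R n (λ k → δ R t k * (S v k * isqrt k))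
        ≈⟨ Σᶠ-cong n (λ k → trans (*-congʳ (δ-sym t k)) (x∙yz≈y∙zx (δ R k t) (S v k) (isqrt k))) ⟩
      Σᶠ R n (λ k → S v k * scaledBasis k t) ∎

    matPow-scaledBasis-suc : ∀ m v j →
      matPow R 𝓛 (suc m) (scaledBasis v) j ≈ Σᶠ R n (λ k → S v k * matPow R 𝓛 m (scaledBasis k) j)
    matPow-scaledBasis-suc m v j = begin
      matPow R 𝓛 (suc m) (scaledBasis v) j
        ≈⟨ matPow-sucʳ 𝓛 m (scaledBasis v) j ⟩
      matPow R 𝓛 m (_·_ R 𝓛 (scaledBasis v)) j
        ≈⟨ matPow-cong 𝓛 m (normLaplacian·scaledBasis v) j ⟩
      matPow R 𝓛 m (λ t → Σᶠ R n (λ k → S v k * scaledBasis k t)) j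
        ≈⟨ matPow-linear 𝓛 m (S v) scaledBasis j ⟩
      Σᶠ R n (λ k → S v k * matPow R 𝓛 m (scaledBasis k) j) ∎

    isqrt*alternatingWalkSum : ∀ half m v j →
      isqrt j * alternatingWalkSum w isqrt half m v j ≈ pow R half m * matPow R 𝓛 m (scaledBasis v) j
    isqrt*alternatingWalkSum half zero v j = begin
      isqrt j * (δ R v j * (1# * 1#) + 0#)
        ≈⟨ *-congˡ (trans (+-identityʳ _) (trans (*-congˡ (*-identityˡ 1#)) (*-identityʳ _))) ⟩
      isqrt j * δ R v j  ≈⟨ *-δ-transfer isqrt v j ⟨
      isqrt v * δ R v j  ≈⟨ *-identityˡ _ ⟨
      1# * scaledBasis v j ∎
    isqrt*alternatingWalkSum half (suc m) v j = begin
      isqrt j * T (suc m) v j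
        ≈⟨ *-congˡ (alternatingWalkSum-suc w isqrt half m v j) ⟩
      isqrt j * (half * Σᶠ R n (λ k → S v k * T m k j))
        ≈⟨ x∙yz≈y∙xz _ _ _ ⟩
      half * (isqrt j * Σᶠ R n (λ k → S v k * T m k j))
        ≈⟨ *-congˡ (x*Σay≈Σa*xy n (isqrt j) (S v) _) ⟩
      half * Σᶠ R n (λ k → S v k * (isqrt j * T m k j))
        ≈⟨ *-congˡ (Σᶠ-cong n (λ k → *-congˡ (isqrt*alternatingWalkSum half m k j))) ⟩
      half * Σᶠ R n (λ k → S v k * (pow R half m * matPow R 𝓛 m (scaledBasis k) j))
        ≈⟨ *-congˡ (x*Σay≈Σa*xy n (pow R half m) (S v) _) ⟨
      half * (pow R half m * Σᶠ R n (λ k → S v k * matPow R 𝓛 m (scaledBasis k) j))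
        ≈⟨ *-assoc _ _ _ ⟨
      pow R half (suc m) * Σᶠ R n (λ k → S v k * matPow R 𝓛 m (scaledBasis k) j)
        ≈⟨ *-congˡ (matPow-scaledBasis-suc m v j) ⟨
      pow R half (suc m) * matPow R 𝓛 (suc m) (scaledBasis v) j ∎
      where T = alternatingWalkSum w isqrt half

claim1 : {c r : Level} (R : CommutativeRing c r) →
    let open CommutativeRing R in
    (n : ℕ) (w : Fin n → Fin n → Carrier) →
    (∀ j k → w j k ≈ w k j) →
    (sqrtd isqrt : Fin n → Carrier) →
    (∀ j → sqrtd j * sqrtd j ≈ degree R w j) →
    (∀ j → isqrt j * sqrtd j ≈ 1#) →
    (half : Carrier) → half + half ≈ 1# →
    (len : ℕ) (i : Fin n) (j : Fin n) →
    qvec R w isqrt half len i j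
      ≈ pow R half len
        * matPow R (normLaplacian R w isqrt) len (λ k → isqrt i * δ R i k) j
claim1 R n w w-sym _ isqrt _ _ half _ len i j =
  trans (qvec≈isqrt*alternatingWalkSum R w isqrt half len i j)
        (isqrt*alternatingWalkSum R w w-sym isqrt half len i j)
  where open CommutativeRing R using (trans)
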